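{- Let $a<b$ be nonnegative integers and let $G$ be a graph with $n$ vertices and minimum degree $\delta(G)\ge a+b$. Then $\gamma_{a,b}(G)\le \frac{2b}{2b+1}\,n$. If moreover $G$ has a spanning $(b-a)$-regular subgraph, then $\gamma_{a,b}(G)\le \frac{a+b}{a+b+1}\, n$. In particular, if $k$ is a positive integer and $G$ is a graph with $\delta(G)\ge 2k-1$ that has a perfect matching, then $\gamma_{k-1,k}(G)\le \frac{2k-1}{2k}\, n$.
   Context: All graphs are finite and simple. For nonnegative integers $a,b$, an $(a,b)$-dominating set of a graph $G$ is a subset $S\subseteq V(G)$ such that every vertex $v\in S$ is adjacent to at least $a$ vertices of $S$ and every vertex $v\in V(G)\setminus S$ is adjacent to at least $b$ vertices of $S$. $\gamma_{a,b}(G)$ denotes the minimum cardinality of an $(a,b)$-dominating set of $G$. A spanning subgraph uses all vertices of $G$. -}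

module Defs where

open import Data.Nat using (ℕ; _≤_)
open import Data.Bool using (Bool; true; false)
open import Data.Fin using (Fin)
open import Data.Fin.Subset using (Subset; _∈_; _∉_; _∩_; ∣_∣)
open import Data.Vec using (tabulate)
open import Data.Product using (Σ; _×_)
open import Relation.Binary.PropositionalEquality using (_≡_)

record Graph (n : ℕ) : Set where
  field
    adj   : Fin n → Fin n → Bool
    sym   : ∀ u v → adj u v ≡ adj v u
    irrfl : ∀ v → adj v v ≡ false
open Graph public

N : ∀ {n} → Graph n → Fin n → Subset n
N G v = tabulate (adj G v)

degIn : ∀ {n} → Graph n → Fin n → Subset n → ℕ
degIn G v S = ∣ N G v ∩ S ∣

deg : ∀ {n} → Graph n → Fin n → ℕ
deg G v = ∣ N G v ∣

MinDegreeAtLeast : ∀ {n} → Graph n → ℕ → Set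
MinDegreeAtLeast G d = ∀ v → d ≤ deg G v

SpanningSubgraph : ∀ {n} → Graph n → Graph n → Set
SpanningSubgraph H G = ∀ u v → adj H u v ≡ true → adj G u v ≡ true

Regular : ∀ {n} → Graph n → ℕ → Set
Regular H r = ∀ v → deg H v ≡ r

HasSpanningRegular : ∀ {n} → Graph n → ℕ → Set
HasSpanningRegular {n} G r = Σ (Graph n) λ H → SpanningSubgraph H G × Regular H r

HasPerfectMatching : ∀ {n} → Graph n → Set
HasPerfectMatching G = HasSpanningRegular G 1

IsDominating : ∀ {n} → ℕ → ℕ → Graph n → Subset n → Set
IsDominating a b G S =
  (∀ v → v ∈ S → a ≤ degIn G v S) × (∀ v → v ∉ S → b ≤ degIn G v S)

-- γ_{a,b}(G) ≤ p/q · n  (q > 0), unfolded: some (a,b)-dominating S has q·|S| ≤ p·n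
open import Data.Nat using (_*_)
GammaBound : ∀ {n} → ℕ → ℕ → Graph n → ℕ → ℕ → Set
GammaBound {n} a b G p q = Σ (Subset n) λ S → IsDominating a b G S × (q * ∣ S ∣ ≤ p * n)

-- Put s = b ∸ a.  Every vertex v selects a star of s neighbours and, among its
-- remaining neighbours, 2a more arranged in a pairs.  The conflict graph joins
-- x and y when one lies in the other's star or {x , y} is one of the n·a pairs.
-- If T is independent in the conflict graph, its complement S is
-- (a,b)-dominating: every pair of v meets S (a neighbours in S), and for v ∈ T
-- the whole star lies in S as well (s + a = b neighbours).  Turán's bound in
-- Caro–Wei form, proved by the greedy minimum-degree algorithm, turns a conflict
-- degree sum ≤ K·n into such a T with n ≤ (K + 1)·|T|, so (K + 1)·|S| ≤ K·n.
-- Arbitrary stars give degree sum ≤ 2sn + 2an = 2bn; stars taken from a spanning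
-- s-regular subgraph are symmetric, giving sn + 2an = (a + b)n; a perfect
-- matching is the case a = k - 1, b = k.

module Submission where

open import Defs renaming (sym to adj-sym)
open import Data.Nat using (ℕ; zero; suc; _+_; _*_; _∸_; _<_; _≤_; z≤n; s≤s; _≤?_)
open import Data.Nat.Properties
  using (+-*-semiring; module ≤-Reasoning; ≤-refl; ≤-reflexive; ≤-trans; ≤-total; ≤-pred; <⇒≤; ≰⇒≥; n≤0⇒n≡0;
         +-comm; +-assoc; +-identityʳ; *-assoc; *-identityˡ; *-identityʳ; *-zeroʳ; *-distribˡ-+; *-distribʳ-+;
         +-mono-≤; +-monoˡ-≤; +-monoʳ-≤; *-monoʳ-≤; +-cancelˡ-≤; +-cancelʳ-≤; *-cancelˡ-≤;
         m≤m+n; m≤n+m; m+[n∸m]≡n; m∸n+n≡m; m+n∸n≡m)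
open import Data.Nat.Tactic.RingSolver using (solve-∀)
open import Data.Bool using (Bool; true; false; _∧_; _∨_; not; if_then_else_)
open import Data.Bool.Properties using (∧-zeroʳ; ∧-identityʳ; ∨-zeroʳ; ∨-comm; ∨-idem)
open import Data.Fin using (Fin; zero; suc; _↑ˡ_; _↑ʳ_; splitAt; combine; remQuot)
open import Data.Fin.Properties
  using (_≟_; suc-injective; 0≢1+n; ↑ˡ-injective; ↑ʳ-injective; splitAt-↑ˡ; splitAt-↑ʳ; remQuot-combine)
open import Data.Fin.Subset using (_∈_; _∉_; _∩_; ∣_∣)
open import Data.Vec using (_∷_; tabulate)
open import Data.Vec.Properties using (lookup∘tabulate; lookup⇒[]=)
open import Data.Product using (Σ; _×_; _,_; proj₁; proj₂; uncurry)
open import Data.Sum using (_⊎_; inj₁; inj₂)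
open import Function using (_∘_)
open import Function.Definitions using (Injective)
open import Relation.Nullary using (Dec; yes; no; does; contradiction)
open import Relation.Nullary.Decidable using (dec-true; dec-false)
open import Relation.Binary.PropositionalEquality
open import Algebra.Properties.Semiring.Sum +-*-semiring
  using (sum; sum-syntax; ∑-comm; ∑-distrib-+; sum-cong-≗; sum-replicate-zero; *-distribʳ-sum)

-- Sets of vertices are handled as Boolean predicates on Fin n, measured by count.

ind : Bool → ℕ
ind true = 1
ind false = 0

count : ∀ {n} → (Fin n → Bool) → ℕ
count {n} p = ∑[ i < n ] ind (p i)

infix 4 _⊑_
_⊑_ : ∀ {n} → (Fin n → Bool) → (Fin n → Bool) → Set
p ⊑ q = ∀ i → p i ≡ true → q i ≡ true

∧-intro : ∀ {b c} → b ≡ true → c ≡ true → b ∧ c ≡ true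
∧-intro = cong₂ _∧_

∧-true₁ : ∀ {b c} → b ∧ c ≡ true → b ≡ true
∧-true₁ {true} _ = refl

∧-true₂ : ∀ {b c} → b ∧ c ≡ true → c ≡ true
∧-true₂ {true} e = e

∧-monoˡ : ∀ {b b′ c} → (b ≡ true → b′ ≡ true) → b ∧ c ≡ true → b′ ∧ c ≡ true
∧-monoˡ {true} b⇒b′ e rewrite b⇒b′ refl = e

∧-⊑ : ∀ {n} {p q : Fin n → Bool} → q ⊑ p → ∀ i → p i ∧ q i ≡ q i
∧-⊑ {p = p} {q} q⊑p i with q i in qi
... | false = ∧-zeroʳ (p i)
... | true rewrite q⊑p i qi = refl

⊑-false : ∀ {n} {p q : Fin n → Bool} → p ⊑ q → ∀ i → q i ≡ false → p i ≡ false
⊑-false {p = p} p⊑q i qi with p i in pi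
... | false = refl
... | true = trans (sym (p⊑q i pi)) qi

sum-mono : ∀ {n} {f g : Fin n → ℕ} → (∀ i → f i ≤ g i) → sum f ≤ sum g
sum-mono {zero} f≤g = z≤n
sum-mono {suc n} f≤g = +-mono-≤ (f≤g zero) (sum-mono (f≤g ∘ suc))

sum-const : ∀ n c → ∑[ i < n ] c ≡ n * c
sum-const zero c = refl
sum-const (suc n) c = cong (c +_) (sum-const n c)

count-cong : ∀ {n} {p q : Fin n → Bool} → (∀ i → p i ≡ q i) → count p ≡ count q
count-cong p≗q = sum-cong-≗ (cong ind ∘ p≗q)

count-mono : ∀ {n} {p q : Fin n → Bool} → p ⊑ q → count p ≤ count q
count-mono {p = p} {q} p⊑q = sum-mono λ i → ind-mono (p i) (q i) (p⊑q i)
  where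
  ind-mono : ∀ b c → (b ≡ true → c ≡ true) → ind b ≤ ind c
  ind-mono false c _ = z≤n
  ind-mono true c b⇒c rewrite b⇒c refl = ≤-refl

count-none : ∀ n → count {n} (λ _ → false) ≡ 0
count-none n = sum-replicate-zero n

count-all : ∀ n → count {n} (λ _ → true) ≡ n
count-all n = trans (sum-const n 1) (*-identityʳ n)

count≤n : ∀ {n} (p : Fin n → Bool) → count p ≤ n
count≤n {n} p = subst (count p ≤_) (count-all n) (count-mono {n} {p} {λ _ → true} (λ _ _ → refl))

ind-∨ : ∀ b c → ind (b ∨ c) ≤ ind b + ind c
ind-∨ true c = s≤s z≤n
ind-∨ false c = ≤-refl

count-∨ : ∀ {n} (p q : Fin n → Bool) → count (λ i → p i ∨ q i) ≤ count p + count q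
count-∨ p q = ≤-trans (sum-mono λ i → ind-∨ (p i) (q i)) (≤-reflexive (∑-distrib-+ (ind ∘ p) (ind ∘ q)))

ind-split : ∀ b c → ind b ≡ ind (b ∧ c) + ind (b ∧ not c)
ind-split true true = refl
ind-split true false = refl
ind-split false c = refl

count-split : ∀ {n} (p q : Fin n → Bool) →
  count p ≡ count (λ i → p i ∧ q i) + count (λ i → p i ∧ not (q i))
count-split p q = trans (sum-cong-≗ λ i → ind-split (p i) (q i))
                        (∑-distrib-+ (λ i → ind (p i ∧ q i)) (λ i → ind (p i ∧ not (q i))))

count-split-⊑ : ∀ {n} {p q : Fin n → Bool} → q ⊑ p →
  count p ≡ count q + count (λ i → p i ∧ not (q i))
count-split-⊑ {p = p} {q} q⊑p =
  trans (count-split p q) (cong (_+ count (λ i → p i ∧ not (q i))) (count-cong (∧-⊑ q⊑p)))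

count-symmetrise : ∀ {n} (R : Fin n → Fin n → Bool) →
  ∑[ x < n ] count (λ y → R x y ∨ R y x) ≤ ∑[ x < n ] count (R x) + ∑[ x < n ] count (R x)
count-symmetrise {n} R = begin
  ∑[ x < n ] count (λ y → R x y ∨ R y x)
    ≤⟨ sum-mono (λ x → count-∨ (R x) (λ y → R y x)) ⟩
  ∑[ x < n ] (count (R x) + count (λ y → R y x))
    ≡⟨ ∑-distrib-+ (λ x → count (R x)) (λ x → count (λ y → R y x)) ⟩
  ∑[ x < n ] count (R x) + ∑[ x < n ] count (λ y → R y x)
    ≡⟨ cong (∑[ x < n ] count (R x) +_) (∑-comm (λ x y → ind (R y x))) ⟩
  ∑[ x < n ] count (R x) + ∑[ x < n ] count (R x) ∎
  where open ≤-Reasoning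

count-singleton : ∀ {n} (c : Fin n) → count (λ y → does (y ≟ c)) ≡ 1
count-singleton {suc n} zero = cong suc (count-none n)
count-singleton {suc n} (suc c) = count-singleton c

count-insert : ∀ {n} (x : Fin n) (p : Fin n → Bool) → p x ≡ false →
  count (λ y → does (y ≟ x) ∨ p y) ≡ suc (count p)
count-insert x p px = begin
  count (λ y → does (y ≟ x) ∨ p y)
    ≡⟨ count-split (λ y → does (y ≟ x) ∨ p y) (λ y → does (y ≟ x)) ⟩
  count (λ y → (does (y ≟ x) ∨ p y) ∧ does (y ≟ x)) + count (λ y → (does (y ≟ x) ∨ p y) ∧ not (does (y ≟ x)))
    ≡⟨ cong₂ _+_ (trans (count-cong λ y → absorb (does (y ≟ x)) (p y)) (count-singleton x))
                 (count-cong λ y → others y (y ≟ x)) ⟩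
  suc (count p) ∎
  where
  open ≡-Reasoning
  absorb : ∀ e b → (e ∨ b) ∧ e ≡ e
  absorb true b = refl
  absorb false b = ∧-zeroʳ b
  others : ∀ y (y≟x : Dec (y ≡ x)) → (does y≟x ∨ p y) ∧ not (does y≟x) ≡ p y
  others y (no _) = ∧-identityʳ (p y)
  others y (yes refl) = sym px

fibre≤ : ∀ {m n} (p : Fin n → Bool) (f : Fin m → Fin n) → Injective _≡_ _≡_ f →
  (∀ k → p (f k) ≡ true) → ∀ y → ∑[ k < m ] ind (does (y ≟ f k)) ≤ ind (p y)
fibre≤ {zero} p f f-inj f∈p y = z≤n
fibre≤ {suc m} p f f-inj f∈p y = by-cases (y ≟ f zero)
  where
  by-cases : ∀ d → ind (does d) + ∑[ k < m ] ind (does (y ≟ f (suc k))) ≤ ind (p y)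
  by-cases (no _) = fibre≤ p (f ∘ suc) (suc-injective ∘ f-inj) (f∈p ∘ suc) y
  by-cases (yes refl) = ≤-reflexive (begin
    1 + ∑[ k < m ] ind (does (f zero ≟ f (suc k)))
      ≡⟨ cong suc (trans (sum-cong-≗ λ k → cong ind (dec-false (f zero ≟ f (suc k)) (0≢1+n ∘ f-inj)))
                         (count-none m)) ⟩
    1 ≡⟨ cong ind (sym (f∈p zero)) ⟩
    ind (p (f zero)) ∎)
    where open ≡-Reasoning

injection⇒≤count : ∀ {m n} (p : Fin n → Bool) (f : Fin m → Fin n) → Injective _≡_ _≡_ f →
  (∀ k → p (f k) ≡ true) → m ≤ count p
injection⇒≤count {m} {n} p f f-inj f∈p = begin
  m                                             ≡⟨ count-all m ⟨
  ∑[ k < m ] 1                                  ≡⟨ sum-cong-≗ (λ k → count-singleton (f k)) ⟨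
  ∑[ k < m ] ∑[ y < n ] ind (does (y ≟ f k))    ≡⟨ ∑-comm (λ k y → ind (does (y ≟ f k))) ⟩
  ∑[ y < n ] ∑[ k < m ] ind (does (y ≟ f k))    ≤⟨ sum-mono (fibre≤ p f f-inj f∈p) ⟩
  count p                                       ∎
  where open ≤-Reasoning

enumerate : ∀ {m n} (p : Fin n → Bool) → m ≤ count p →
  Σ (Fin m → Fin n) λ f → Injective _≡_ _≡_ f × (∀ k → p (f k) ≡ true)
enumerate {zero} p _ = (λ ()) , (λ {}) , (λ ())
enumerate {suc m} {suc n} p m≤ with p zero in p0
... | true = f , f-inj , f∈p
  where
  rest = enumerate {m} (p ∘ suc) (≤-pred m≤)
  f : Fin (suc m) → Fin (suc n)
  f zero = zero
  f (suc k) = suc (proj₁ rest k)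
  f-inj : Injective _≡_ _≡_ f
  f-inj {zero} {zero} _ = refl
  f-inj {suc i} {suc j} e = cong suc (proj₁ (proj₂ rest) (suc-injective e))
  f∈p : ∀ k → p (f k) ≡ true
  f∈p zero = p0
  f∈p (suc k) = proj₂ (proj₂ rest) k
... | false = suc ∘ proj₁ rest , proj₁ (proj₂ rest) ∘ suc-injective , proj₂ (proj₂ rest)
  where rest = enumerate {suc m} (p ∘ suc) m≤

prefix : ∀ {n} → ℕ → (Fin n → Bool) → Fin n → Bool
prefix zero p i = false
prefix (suc k) p zero = p zero
prefix (suc k) p (suc i) = prefix (if p zero then k else suc k) (p ∘ suc) i

prefix-⊑ : ∀ {n} k (p : Fin n → Bool) → prefix k p ⊑ p
prefix-⊑ zero p i ()
prefix-⊑ (suc k) p zero e = e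
prefix-⊑ (suc k) p (suc i) e with p zero
... | true = prefix-⊑ k (p ∘ suc) i e
... | false = prefix-⊑ (suc k) (p ∘ suc) i e

count-prefix : ∀ {n} k (p : Fin n → Bool) → k ≤ count p → count (prefix k p) ≡ k
count-prefix {n} zero p _ = count-none n
count-prefix {suc n} (suc k) p k<|p| with p zero
... | true = cong suc (count-prefix k (p ∘ suc) (≤-pred k<|p|))
... | false = count-prefix (suc k) (p ∘ suc) k<|p|

anyᵇ : ∀ {m} → (Fin m → Bool) → Bool
anyᵇ {zero} f = false
anyᵇ {suc m} f = f zero ∨ anyᵇ (f ∘ suc)

anyᵇ-intro : ∀ {m} (f : Fin m → Bool) k → f k ≡ true → anyᵇ f ≡ true
anyᵇ-intro f zero fk rewrite fk = refl
anyᵇ-intro f (suc k) fk = trans (cong (f zero ∨_) (anyᵇ-intro (f ∘ suc) k fk)) (∨-zeroʳ (f zero))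

ind-anyᵇ : ∀ {m} (f : Fin m → Bool) → ind (anyᵇ f) ≤ ∑[ k < m ] ind (f k)
ind-anyᵇ {zero} f = z≤n
ind-anyᵇ {suc m} f = ≤-trans (ind-∨ (f zero) _) (+-monoʳ-≤ (ind (f zero)) (ind-anyᵇ (f ∘ suc)))

IsPair : ∀ {m n} → (Fin m → Fin n) → (Fin m → Fin n) → Fin n → Fin n → Bool
IsPair l r x y = anyᵇ λ i → does (x ≟ l i) ∧ does (y ≟ r i)

isPair-hit : ∀ {m n} (l r : Fin m → Fin n) i → IsPair l r (l i) (r i) ≡ true
isPair-hit l r i = anyᵇ-intro _ i (∧-intro (dec-true (l i ≟ l i) refl) (dec-true (r i ≟ r i) refl))

count-isPair : ∀ {m n} (l r : Fin m → Fin n) → ∑[ x < n ] count (IsPair l r x) ≤ m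
count-isPair {m} {n} l r = begin
  ∑[ x < n ] ∑[ y < n ] ind (IsPair l r x y)
    ≤⟨ sum-mono (λ x → sum-mono λ y → ind-anyᵇ λ i → δ i x y) ⟩
  ∑[ x < n ] ∑[ y < n ] ∑[ i < m ] ind (δ i x y)
    ≡⟨ sum-cong-≗ (λ x → ∑-comm λ y i → ind (δ i x y)) ⟩
  ∑[ x < n ] ∑[ i < m ] ∑[ y < n ] ind (δ i x y)
    ≡⟨ ∑-comm (λ x i → ∑[ y < n ] ind (δ i x y)) ⟩
  ∑[ i < m ] ∑[ x < n ] ∑[ y < n ] ind (δ i x y)
    ≡⟨ sum-cong-≗ (λ i → one-pair (l i) (r i)) ⟩
  ∑[ i < m ] 1
    ≡⟨ count-all m ⟩
  m ∎
  where
  open ≤-Reasoning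
  δ : Fin m → Fin n → Fin n → Bool
  δ i x y = does (x ≟ l i) ∧ does (y ≟ r i)
  row : ∀ b (c : Fin n) → ∑[ y < n ] ind (b ∧ does (y ≟ c)) ≡ ind b
  row true c = count-singleton c
  row false c = count-none n
  one-pair : ∀ (c d : Fin n) → ∑[ x < n ] ∑[ y < n ] ind (does (x ≟ c) ∧ does (y ≟ d)) ≡ 1
  one-pair c d = trans (sum-cong-≗ λ x → row (does (x ≟ c)) d) (count-singleton c)

minimiser : ∀ {n} (U : Fin n → Bool) (f : Fin n → ℕ) →
  (∀ y → U y ≡ false) ⊎ Σ (Fin n) λ x → U x ≡ true × (∀ y → U y ≡ true → f x ≤ f y)
minimiser {zero} U f = inj₁ λ ()
minimiser {suc n} U f with minimiser (U ∘ suc) (f ∘ suc) | U zero in u0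
... | inj₁ none | false = inj₁ λ { zero → u0 ; (suc y) → none y }
... | inj₁ none | true =
  inj₂ (zero , u0 , λ { zero _ → ≤-refl ; (suc y) uy → contradiction (trans (sym uy) (none y)) λ () })
... | inj₂ (x , ux , least) | false =
  inj₂ (suc x , ux , λ { zero uy → contradiction (trans (sym uy) u0) λ () ; (suc y) uy → least y uy })
... | inj₂ (x , ux , least) | true with f zero ≤? f (suc x)
...   | yes ≤x = inj₂ (zero , u0 , λ { zero _ → ≤-refl ; (suc y) uy → ≤-trans ≤x (least y uy) })
...   | no ≰x = inj₂ (suc x , ux , λ { zero _ → ≰⇒≥ ≰x ; (suc y) uy → least y uy })

≤-by-gap : ∀ {lhs rhs} gap → lhs + gap ≡ rhs → lhs ≤ rhs
≤-by-gap {lhs} gap eq = ≤-trans (m≤m+n lhs gap) (≤-reflexive eq)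

-- the arithmetic heart of the greedy step: the difference of the two sides is (K - d)²
square-gap : ∀ K d → (2 * K + 1) * suc d ≤ (K + 1) * (K + 1) + suc d * d
square-gap K d with ≤-total d K
... | inj₁ d≤K = subst (λ k → (2 * k + 1) * suc d ≤ (k + 1) * (k + 1) + suc d * d)
                       (m+[n∸m]≡n d≤K) (≤-by-gap _ (d≤K-identity d (K ∸ d)))
  where
  d≤K-identity : ∀ d e → (2 * (d + e) + 1) * suc d + e * e ≡ (d + e + 1) * (d + e + 1) + suc d * d
  d≤K-identity = solve-∀
... | inj₂ K≤d = subst (λ k → (2 * K + 1) * suc k ≤ (K + 1) * (K + 1) + suc k * k)
                       (m+[n∸m]≡n K≤d) (≤-by-gap _ (K≤d-identity K (d ∸ K)))
  where
  K≤d-identity : ∀ K e → (2 * K + 1) * suc (K + e) + e * e ≡ (K + 1) * (K + 1) + suc (K + e) * (K + e)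
  K≤d-identity = solve-∀

Independent : ∀ {n} → Graph n → (Fin n → Bool) → Set
Independent C T = ∀ x y → T x ≡ true → T y ≡ true → adj C x y ≡ false

module Greedy {n : ℕ} (C : Graph n) (K : ℕ) where

  degreeIn : (Fin n → Bool) → Fin n → ℕ
  degreeIn U x = count (λ y → U y ∧ adj C x y)

  weight : (Fin n → Bool) → ℕ
  weight U = ∑[ x < n ] (ind (U x) * degreeIn U x)

  degreeIn-mono : ∀ {U′ U} → U′ ⊑ U → ∀ x → degreeIn U′ x ≤ degreeIn U x
  degreeIn-mono U′⊑U x = count-mono λ y → ∧-monoˡ (U′⊑U y)

  -- the invariant of the greedy algorithm; for U = everything it yields Turán's bound
  GreedyBound : (Fin n → Bool) → Set
  GreedyBound U = Σ (Fin n → Bool) λ T → T ⊑ U × Independent C T ×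
    ((2 * K + 1) * count U ≤ (K + 1) * (K + 1) * count T + weight U)

  empty-bound : ∀ U → count U ≡ 0 → GreedyBound U
  empty-bound U |U|≡0 = (λ _ → false) , (λ _ ()) , (λ _ _ ()) ,
    ≤-trans (≤-reflexive (trans (cong ((2 * K + 1) *_) |U|≡0) (*-zeroʳ (2 * K + 1)))) z≤n

  module Step (U : Fin n → Bool) (x : Fin n) (x∈U : U x ≡ true)
              (least : ∀ y → U y ≡ true → degreeIn U x ≤ degreeIn U y) where

    d : ℕ
    d = degreeIn U x

    closedIn : Fin n → Bool
    closedIn y = does (y ≟ x) ∨ (U y ∧ adj C x y)

    rest : Fin n → Bool
    rest y = U y ∧ not (closedIn y)

    closedIn-size : count closedIn ≡ suc d
    closedIn-size = count-insert x (λ y → U y ∧ adj C x y) (trans (cong (U x ∧_) (irrfl C x)) (∧-zeroʳ (U x)))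

    closedIn-⊑ : closedIn ⊑ U
    closedIn-⊑ y e with y ≟ x
    ... | yes refl = x∈U
    ... | no _ = ∧-true₁ e

    size-split : count U ≡ suc d + count rest
    size-split = trans (count-split-⊑ closedIn-⊑) (cong (_+ count rest) closedIn-size)

    rest-avoids : ∀ y → rest y ≡ true → adj C x y ≡ false
    rest-avoids y = avoid (U y) (does (y ≟ x)) (adj C x y)
      where
      avoid : ∀ u e a → u ∧ not (e ∨ (u ∧ a)) ≡ true → a ≡ false
      avoid true false false _ = refl

    x∉rest : rest x ≡ false
    x∉rest rewrite dec-true (x ≟ x) refl = ∧-zeroʳ (U x)

    -- the d + 1 deleted vertices all have degree ≥ d, and no degree grows
    weight-drop : weight rest + suc d * d ≤ weight U
    weight-drop = begin
      weight rest + suc d * d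
        ≡⟨ cong (λ c → weight rest + c * d) closedIn-size ⟨
      weight rest + count closedIn * d
        ≡⟨ cong (weight rest +_) (*-distribʳ-sum d (ind ∘ closedIn)) ⟩
      weight rest + ∑[ y < n ] (ind (closedIn y) * d)
        ≤⟨ +-mono-≤ (sum-mono λ y → *-monoʳ-≤ (ind (rest y)) (degreeIn-mono (λ _ → ∧-true₁) y))
                    (sum-mono closed-term) ⟩
      ∑[ y < n ] (ind (rest y) * degreeIn U y) + ∑[ y < n ] (ind (closedIn y) * degreeIn U y)
        ≡⟨ ∑-distrib-+ (λ y → ind (rest y) * degreeIn U y) (λ y → ind (closedIn y) * degreeIn U y) ⟨
      ∑[ y < n ] (ind (rest y) * degreeIn U y + ind (closedIn y) * degreeIn U y)
        ≡⟨ sum-cong-≗ split ⟨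
      weight U ∎
      where
      open ≤-Reasoning
      closed-term : ∀ y → ind (closedIn y) * d ≤ ind (closedIn y) * degreeIn U y
      closed-term y with closedIn y in e
      ... | false = z≤n
      ... | true = *-monoʳ-≤ 1 (least y (closedIn-⊑ y e))
      split : ∀ y → ind (U y) * degreeIn U y ≡ ind (rest y) * degreeIn U y + ind (closedIn y) * degreeIn U y
      split y = begin-equality
        ind (U y) * degreeIn U y
          ≡⟨ cong (λ i → i * degreeIn U y)
                  (trans (ind-split (U y) (closedIn y)) (cong (λ b → ind b + ind (rest y)) (∧-⊑ closedIn-⊑ y))) ⟩
        (ind (closedIn y) + ind (rest y)) * degreeIn U y
          ≡⟨ cong (_* degreeIn U y) (+-comm (ind (closedIn y)) (ind (rest y))) ⟩
        (ind (rest y) + ind (closedIn y)) * degreeIn U y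
          ≡⟨ *-distribʳ-+ (degreeIn U y) (ind (rest y)) (ind (closedIn y)) ⟩
        ind (rest y) * degreeIn U y + ind (closedIn y) * degreeIn U y ∎

    grow : GreedyBound rest → GreedyBound U
    grow (T , T⊑rest , T-indep , bound) = T′ , T′⊑U , T′-indep , bound′
      where
      T′ : Fin n → Bool
      T′ y = does (y ≟ x) ∨ T y
      T′-size : count T′ ≡ suc (count T)
      T′-size = count-insert x T (⊑-false T⊑rest x x∉rest)
      T′⊑U : T′ ⊑ U
      T′⊑U y e with y ≟ x
      ... | yes refl = x∈U
      ... | no _ = ∧-true₁ (T⊑rest y e)
      T′-indep : Independent C T′
      T′-indep y z ey ez with y ≟ x | z ≟ x
      ... | yes refl | yes refl = irrfl C x
      ... | yes refl | no _ = rest-avoids z (T⊑rest z ez)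
      ... | no _ | yes refl = trans (adj-sym C y x) (rest-avoids y (T⊑rest y ey))
      ... | no _ | no _ = T-indep y z ey ez
      A : ℕ
      A = (K + 1) * (K + 1)
      regroup : ∀ A D W c → (A + D) + (A * c + W) ≡ A * suc c + (W + D)
      regroup = solve-∀
      bound′ : (2 * K + 1) * count U ≤ A * count T′ + weight U
      bound′ = begin
        (2 * K + 1) * count U
          ≡⟨ cong ((2 * K + 1) *_) size-split ⟩
        (2 * K + 1) * (suc d + count rest)
          ≡⟨ *-distribˡ-+ (2 * K + 1) (suc d) (count rest) ⟩
        (2 * K + 1) * suc d + (2 * K + 1) * count rest
          ≤⟨ +-mono-≤ (square-gap K d) bound ⟩
        (A + suc d * d) + (A * count T + weight rest)
          ≡⟨ regroup A (suc d * d) (weight rest) (count T) ⟩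
        A * suc (count T) + (weight rest + suc d * d)
          ≤⟨ +-mono-≤ (≤-reflexive (cong (A *_) (sym T′-size))) weight-drop ⟩
        A * count T′ + weight U ∎
        where open ≤-Reasoning

  greedy : ∀ m U → count U ≤ m → GreedyBound U
  greedy zero U |U|≤0 = empty-bound U (n≤0⇒n≡0 |U|≤0)
  greedy (suc m) U |U|≤1+m with minimiser U (degreeIn U)
  ... | inj₁ empty = empty-bound U (trans (count-cong empty) (count-none n))
  ... | inj₂ (x , x∈U , least) = grow (greedy m rest |rest|≤m)
    where
    open Step U x x∈U least
    |rest|≤m : count rest ≤ m
    |rest|≤m = ≤-pred (≤-trans (s≤s (m≤n+m (count rest) d)) (subst (_≤ suc m) size-split |U|≤1+m))

  turán : ∑[ x < n ] count (adj C x) ≤ K * n → Σ (Fin n → Bool) λ T → Independent C T × n ≤ (K + 1) * count T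
  turán degree-sum with greedy n (λ _ → true) (count≤n (λ _ → true))
  ... | T , _ , T-indep , bound = T , T-indep , *-cancelˡ-≤ (suc K) (+-cancelʳ-≤ (K * n) _ _ (begin
    suc K * n + K * n
      ≡⟨ split-2K+1 K n ⟩
    (2 * K + 1) * n
      ≡⟨ cong ((2 * K + 1) *_) (count-all n) ⟨
    (2 * K + 1) * count {n} (λ _ → true)
      ≤⟨ bound ⟩
    (K + 1) * (K + 1) * count T + weight (λ _ → true)
      ≡⟨ cong ((K + 1) * (K + 1) * count T +_) (sum-cong-≗ λ x → *-identityˡ (count (adj C x))) ⟩
    (K + 1) * (K + 1) * count T + ∑[ x < n ] count (adj C x)
      ≤⟨ +-monoʳ-≤ ((K + 1) * (K + 1) * count T) degree-sum ⟩
    (K + 1) * (K + 1) * count T + K * n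
      ≡⟨ cong (_+ K * n) (*-assoc (K + 1) (K + 1) (count T)) ⟩
    (K + 1) * ((K + 1) * count T) + K * n
      ≡⟨ cong (λ k → k * ((K + 1) * count T) + K * n) (+-comm K 1) ⟩
    suc K * ((K + 1) * count T) + K * n ∎))
    where
    open ≤-Reasoning
    split-2K+1 : ∀ K n → suc K * n + K * n ≡ (2 * K + 1) * n
    split-2K+1 = solve-∀

-- The Subset n of the statement is the tabulation of a predicate.

∣tabulate∣ : ∀ {n} (f : Fin n → Bool) → ∣ tabulate f ∣ ≡ count f
∣tabulate∣ {zero} f = refl
∣tabulate∣ {suc n} f with f zero
... | true = cong suc (∣tabulate∣ (f ∘ suc))
... | false = ∣tabulate∣ (f ∘ suc)

∩-tabulate : ∀ {n} (f g : Fin n → Bool) → tabulate f ∩ tabulate g ≡ tabulate (λ i → f i ∧ g i)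
∩-tabulate {zero} f g = refl
∩-tabulate {suc n} f g = cong (f zero ∧ g zero ∷_) (∩-tabulate (f ∘ suc) (g ∘ suc))

∈-tabulate : ∀ {n} (f : Fin n → Bool) v → f v ≡ true → v ∈ tabulate f
∈-tabulate f v e = lookup⇒[]= v (tabulate f) (trans (lookup∘tabulate f v) e)

deg≡count : ∀ {n} (G : Graph n) v → deg G v ≡ count (adj G v)
deg≡count G v = ∣tabulate∣ (adj G v)

degIn-tabulate : ∀ {n} (G : Graph n) v (f : Fin n → Bool) → degIn G v (tabulate f) ≡ count (λ y → adj G v y ∧ f y)
degIn-tabulate G v f = trans (cong ∣_∣ (∩-tabulate (adj G v) f)) (∣tabulate∣ (λ y → adj G v y ∧ f y))

↑ˡ≢↑ʳ : ∀ {m} n (i : Fin m) (j : Fin n) → i ↑ˡ n ≢ m ↑ʳ j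
↑ˡ≢↑ʳ {m} n i j e with trans (sym (splitAt-↑ˡ m i n)) (trans (cong (splitAt m) e) (splitAt-↑ʳ m n j))
... | ()

adjacent⇒distinct : ∀ {n} (G : Graph n) v y → adj G v y ≡ true → does (v ≟ y) ≡ false
adjacent⇒distinct G v y e = dec-false (v ≟ y) λ { refl → contradiction (trans (sym e) (irrfl G v)) λ () }

complement-bound : ∀ K n t c → n ≡ t + c → n ≤ (K + 1) * t → (K + 1) * c ≤ K * n
complement-bound K n t c n≡t+c n≤ = +-cancelʳ-≤ n _ _ (begin
  (K + 1) * c + n           ≤⟨ +-monoʳ-≤ ((K + 1) * c) n≤ ⟩
  (K + 1) * c + (K + 1) * t ≡⟨ regroup K t c ⟩
  K * (t + c) + (t + c)     ≡⟨ cong (λ m → K * m + m) n≡t+c ⟨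
  K * n + n ∎)
  where
  open ≤-Reasoning
  regroup : ∀ K t c → (K + 1) * c + (K + 1) * t ≡ K * (t + c) + (t + c)
  regroup = solve-∀

module Construction {n : ℕ} (G : Graph n) (a b s K : ℕ)
  (Star : Fin n → Fin n → Bool)
  (Star⊑G : ∀ v → Star v ⊑ adj G v)
  (star-size : ∀ v → s ≤ count (Star v))
  (spare-size : ∀ v → a + a ≤ count (λ y → adj G v y ∧ not (Star v y)))
  (b≤s+a : b ≤ s + a)
  (budget : ∑[ x < n ] count (λ y → Star x y ∨ Star y x) + 2 * (a * n) ≤ K * n) where

  Spare : Fin n → Fin n → Bool
  Spare v y = adj G v y ∧ not (Star v y)

  spares : ∀ v → Σ (Fin (a + a) → Fin n) λ f → Injective _≡_ _≡_ f × (∀ k → Spare v (f k) ≡ true)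
  spares v = enumerate (Spare v) (spare-size v)

  left right : Fin n → Fin a → Fin n
  left v j = proj₁ (spares v) (j ↑ˡ a)
  right v j = proj₁ (spares v) (a ↑ʳ j)

  left-spare : ∀ v j → Spare v (left v j) ≡ true
  left-spare v j = proj₂ (proj₂ (spares v)) (j ↑ˡ a)

  right-spare : ∀ v j → Spare v (right v j) ≡ true
  right-spare v j = proj₂ (proj₂ (spares v)) (a ↑ʳ j)

  left-injective : ∀ v → Injective _≡_ _≡_ (left v)
  left-injective v e = ↑ˡ-injective a _ _ (proj₁ (proj₂ (spares v)) e)

  right-injective : ∀ v → Injective _≡_ _≡_ (right v)
  right-injective v e = ↑ʳ-injective a _ _ (proj₁ (proj₂ (spares v)) e)

  left≢right : ∀ v i j → left v i ≢ right v j
  left≢right v i j e = ↑ˡ≢↑ʳ a i j (proj₁ (proj₂ (spares v)) e)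

  pairL pairR : Fin (n * a) → Fin n
  pairL = uncurry left ∘ remQuot a
  pairR = uncurry right ∘ remQuot a

  pair-hit : ∀ v j → IsPair pairL pairR (left v j) (right v j) ≡ true
  pair-hit v j = subst (λ (p : Fin n × Fin a) → IsPair pairL pairR (uncurry left p) (uncurry right p) ≡ true)
                       (remQuot-combine v j) (isPair-hit pairL pairR (combine v j))

  StarLink PairLink Linked : Fin n → Fin n → Bool
  StarLink x y = Star x y ∨ Star y x
  PairLink x y = IsPair pairL pairR x y ∨ IsPair pairL pairR y x
  Linked x y = StarLink x y ∨ PairLink x y

  conflict : Graph n
  conflict = record
    { adj   = λ x y → not (does (x ≟ y)) ∧ Linked x y
    ; sym   = λ x y → cong₂ _∧_ (cong not (≟-sym x y)) (linked-sym x y)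
    ; irrfl = λ x → cong (λ b → not b ∧ Linked x x) (dec-true (x ≟ x) refl)
    }
    where
    ≟-sym : ∀ x y → does (x ≟ y) ≡ does (y ≟ x)
    ≟-sym x y with x ≟ y | y ≟ x
    ... | yes _ | yes _ = refl
    ... | no _ | no _ = refl
    ... | yes refl | no x≢x = contradiction refl x≢x
    ... | no x≢x | yes refl = contradiction refl x≢x
    linked-sym : ∀ x y → Linked x y ≡ Linked y x
    linked-sym x y = cong₂ _∨_ (∨-comm (Star x y) (Star y x)) (∨-comm (IsPair pairL pairR x y) _)

  conflict-degrees : ∑[ x < n ] count (adj conflict x) ≤ K * n
  conflict-degrees = begin
    ∑[ x < n ] count (adj conflict x)
      ≤⟨ sum-mono (λ x → count-mono {q = Linked x} λ y → ∧-true₂ {not (does (x ≟ y))}) ⟩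
    ∑[ x < n ] count (Linked x)
      ≤⟨ sum-mono (λ x → count-∨ (StarLink x) (PairLink x)) ⟩
    ∑[ x < n ] (count (StarLink x) + count (PairLink x))
      ≡⟨ ∑-distrib-+ (count ∘ StarLink) (count ∘ PairLink) ⟩
    ∑[ x < n ] count (StarLink x) + ∑[ x < n ] count (PairLink x)
      ≤⟨ +-monoʳ-≤ _ (≤-trans (count-symmetrise (IsPair pairL pairR)) (+-mono-≤ pairs pairs)) ⟩
    ∑[ x < n ] count (StarLink x) + (n * a + n * a)
      ≡⟨ cong (∑[ x < n ] count (StarLink x) +_) (double n a) ⟩
    ∑[ x < n ] count (StarLink x) + 2 * (a * n)
      ≤⟨ budget ⟩
    K * n ∎
    where
    open ≤-Reasoning
    pairs : ∑[ x < n ] count (IsPair pairL pairR x) ≤ n * a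
    pairs = count-isPair pairL pairR
    double : ∀ n a → n * a + n * a ≡ 2 * (a * n)
    double = solve-∀

  open Greedy conflict K using (turán)

  T : Fin n → Bool
  T = proj₁ (turán conflict-degrees)

  T-independent : Independent conflict T
  T-independent = proj₁ (proj₂ (turán conflict-degrees))

  T-large : n ≤ (K + 1) * count T
  T-large = proj₂ (proj₂ (turán conflict-degrees))

  S : Fin n → Bool
  S y = not (T y)

  not-both-in-T : ∀ x y → adj conflict x y ≡ true → T x ≡ true → S y ≡ true
  not-both-in-T x y xy Tx with T y in Ty
  ... | false = refl
  ... | true = contradiction (trans (sym xy) (T-independent x y Tx Ty)) λ ()

  star-conflict : ∀ v y → Star v y ≡ true → adj conflict v y ≡ true
  star-conflict v y vy rewrite adjacent⇒distinct G v y (Star⊑G v y vy) | vy = refl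

  pair-conflict : ∀ v j → adj conflict (left v j) (right v j) ≡ true
  pair-conflict v j rewrite dec-false (left v j ≟ right v j) (left≢right v j j) | pair-hit v j =
    ∨-zeroʳ (StarLink (left v j) (right v j))

  chosen : Fin n → Fin a → Fin n
  chosen v j = if S (left v j) then left v j else right v j

  chosen-in-S : ∀ v j → S (chosen v j) ≡ true
  chosen-in-S v j with S (left v j) in Sl
  ... | true = Sl
  ... | false = not-both-in-T (left v j) (right v j) (pair-conflict v j) (not-false Sl)
    where
    not-false : ∀ {b} → not b ≡ false → b ≡ true
    not-false {true} _ = refl

  chosen-spare : ∀ v j → Spare v (chosen v j) ≡ true
  chosen-spare v j with S (left v j)
  ... | true = left-spare v j
  ... | false = right-spare v j

  chosen-injective : ∀ v → Injective _≡_ _≡_ (chosen v)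
  chosen-injective v {i} {j} e with S (left v i) | S (left v j)
  ... | true | true = left-injective v e
  ... | true | false = contradiction e (left≢right v i j)
  ... | false | true = contradiction (sym e) (left≢right v j i)
  ... | false | false = right-injective v e

  -- every vertex has a neighbours in S, one from each of its pairs
  spare-neighbours-in-S : ∀ v → a ≤ count (λ y → (adj G v y ∧ S y) ∧ not (Star v y))
  spare-neighbours-in-S v = injection⇒≤count _ (chosen v) (chosen-injective v) hit
    where
    hit : ∀ j → (adj G v (chosen v j) ∧ S (chosen v j)) ∧ not (Star v (chosen v j)) ≡ true
    hit j = ∧-intro (∧-intro (∧-true₁ (chosen-spare v j)) (chosen-in-S v j))
                    (∧-true₂ {adj G v (chosen v j)} (chosen-spare v j))

  star-neighbours-in-S : ∀ v → T v ≡ true → s ≤ count (λ y → (adj G v y ∧ S y) ∧ Star v y)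
  star-neighbours-in-S v Tv = ≤-trans (star-size v) (count-mono hit)
    where
    hit : Star v ⊑ (λ y → (adj G v y ∧ S y) ∧ Star v y)
    hit y vy = ∧-intro (∧-intro (Star⊑G v y vy) (not-both-in-T v y (star-conflict v y vy) Tv)) vy

  neighbours-in-S : ∀ v → degIn G v (tabulate S) ≡
    count (λ y → (adj G v y ∧ S y) ∧ Star v y) + count (λ y → (adj G v y ∧ S y) ∧ not (Star v y))
  neighbours-in-S v = trans (degIn-tabulate G v S) (count-split (λ y → adj G v y ∧ S y) (Star v))

  dominating : IsDominating a b G (tabulate S)
  dominating = inside , outside
    where
    inside : ∀ v → v ∈ tabulate S → a ≤ degIn G v (tabulate S)
    inside v _ = ≤-trans (spare-neighbours-in-S v) (≤-trans (m≤n+m _ _) (≤-reflexive (sym (neighbours-in-S v))))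
    outside : ∀ v → v ∉ tabulate S → b ≤ degIn G v (tabulate S)
    outside v v∉S with T v in Tv
    ... | false = contradiction (∈-tabulate S v (cong not Tv)) v∉S
    ... | true = ≤-trans b≤s+a (≤-trans (+-mono-≤ (star-neighbours-in-S v Tv) (spare-neighbours-in-S v))
                                        (≤-reflexive (sym (neighbours-in-S v))))

  small : (K + 1) * ∣ tabulate S ∣ ≤ K * n
  small = subst (λ c → (K + 1) * c ≤ K * n) (sym (∣tabulate∣ S))
                (complement-bound K n (count T) (count S) (trans (sym (count-all n)) (count-split (λ _ → true) T)) T-large)

  result : GammaBound a b G K (K + 1)
  result = tabulate S , dominating , small

module Split (a b : ℕ) (a<b : a < b) where
  s : ℕ
  s = b ∸ a
  s+a≡b : s + a ≡ b
  s+a≡b = m∸n+n≡m (<⇒≤ a<b)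
  s+2a≡a+b : s + (a + a) ≡ a + b
  s+2a≡a+b = trans (sym (+-assoc s a a)) (trans (cong (_+ a) s+a≡b) (+-comm b a))
  b≤s+a : b ≤ s + a
  b≤s+a = ≤-reflexive (sym s+a≡b)

spare-count : ∀ {n} (p q : Fin n → Bool) s a → q ⊑ p → count q ≡ s → s + a ≤ count p →
  a ≤ count (λ y → p y ∧ not (q y))
spare-count p q s a q⊑p |q|≡s s+a≤ = +-cancelˡ-≤ s _ _
  (≤-trans s+a≤ (≤-reflexive (trans (count-split-⊑ q⊑p) (cong (_+ _) |q|≡s))))

regular-degree-sum : ∀ {n} (R : Fin n → Fin n → Bool) s → (∀ x → count (R x) ≡ s) → ∑[ x < n ] count (R x) ≡ n * s
regular-degree-sum {n} R s reg = trans (sum-cong-≗ reg) (sum-const n s)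

general-bound : ∀ (a b n : ℕ) (G : Graph n) → a < b → MinDegreeAtLeast G (a + b) →
  GammaBound a b G (2 * b) (2 * b + 1)
general-bound a b n G a<b δ =
  Construction.result G a b s (2 * b) Star (λ v → prefix-⊑ s (adj G v)) (λ v → ≤-reflexive (sym (|Star| v)))
    (λ v → spare-count (adj G v) (Star v) s (a + a) (prefix-⊑ s (adj G v)) (|Star| v) (large v)) b≤s+a budget
  where
  open Split a b a<b
  large : ∀ v → s + (a + a) ≤ count (adj G v)
  large v = subst₂ _≤_ (sym s+2a≡a+b) (deg≡count G v) (δ v)
  Star : Fin n → Fin n → Bool
  Star v = prefix s (adj G v)
  |Star| : ∀ v → count (Star v) ≡ s
  |Star| v = count-prefix s (adj G v) (≤-trans (m≤m+n s (a + a)) (large v))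
  budget : ∑[ x < n ] count (λ y → Star x y ∨ Star y x) + 2 * (a * n) ≤ 2 * b * n
  budget = begin
    ∑[ x < n ] count (λ y → Star x y ∨ Star y x) + 2 * (a * n)
      ≤⟨ +-monoˡ-≤ (2 * (a * n)) (count-symmetrise Star) ⟩
    ∑[ x < n ] count (Star x) + ∑[ x < n ] count (Star x) + 2 * (a * n)
      ≡⟨ cong (λ t → t + t + 2 * (a * n)) (regular-degree-sum Star s |Star|) ⟩
    n * s + n * s + 2 * (a * n)
      ≡⟨ regroup n s a ⟩
    2 * (s + a) * n
      ≡⟨ cong (λ t → 2 * t * n) s+a≡b ⟩
    2 * b * n ∎
    where
    open ≤-Reasoning
    regroup : ∀ n s a → n * s + n * s + 2 * (a * n) ≡ 2 * (s + a) * n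
    regroup = solve-∀

-- stars: the neighbourhoods in a spanning (b ∸ a)-regular H, which is symmetric,
-- so its edges are counted once; conflict degree sum ≤ (a + b)n
regular-bound : ∀ (a b n : ℕ) (G : Graph n) → a < b → MinDegreeAtLeast G (a + b) →
  HasSpanningRegular G (b ∸ a) → GammaBound a b G (a + b) (a + b + 1)
regular-bound a b n G a<b δ (H , H⊑G , H-regular) =
  Construction.result G a b s (a + b) (adj H) H⊑G (λ v → ≤-reflexive (sym (|H| v)))
    (λ v → spare-count (adj G v) (adj H v) s (a + a) (H⊑G v) (|H| v) (subst₂ _≤_ (sym s+2a≡a+b) (deg≡count G v) (δ v)))
    b≤s+a budget
  where
  open Split a b a<b
  |H| : ∀ v → count (adj H v) ≡ s
  |H| v = trans (sym (deg≡count H v)) (H-regular v)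
  budget : ∑[ x < n ] count (λ y → adj H x y ∨ adj H y x) + 2 * (a * n) ≤ (a + b) * n
  budget = ≤-reflexive (begin
    ∑[ x < n ] count (λ y → adj H x y ∨ adj H y x) + 2 * (a * n)
      ≡⟨ cong (_+ 2 * (a * n)) (sum-cong-≗ λ x → count-cong λ y → trans (cong (adj H x y ∨_) (adj-sym H y x)) (∨-idem _)) ⟩
    ∑[ x < n ] count (adj H x) + 2 * (a * n)
      ≡⟨ cong (_+ 2 * (a * n)) (regular-degree-sum (adj H) s |H|) ⟩
    n * s + 2 * (a * n)
      ≡⟨ regroup n s a ⟩
    (s + (a + a)) * n
      ≡⟨ cong (_* n) s+2a≡a+b ⟩
    (a + b) * n ∎)
    where
    open ≡-Reasoning
    regroup : ∀ n s a → n * s + 2 * (a * n) ≡ (s + (a + a)) * n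
    regroup = solve-∀

matching-bound : ∀ (k n : ℕ) (G : Graph n) → 1 ≤ k → MinDegreeAtLeast G (2 * k ∸ 1) →
  HasPerfectMatching G → GammaBound (k ∸ 1) k G (2 * k ∸ 1) (2 * k)
matching-bound (suc k) n G _ δ (M , M⊑G , M-regular) =
  subst₂ (GammaBound k (suc k) G) 2k+1≡ 2k+2≡
    (regular-bound k (suc k) n G ≤-refl (λ v → subst (_≤ deg G v) (sym 2k+1≡) (δ v))
      (M , M⊑G , λ v → trans (M-regular v) (sym (m+n∸n≡m 1 k))))
  where
  2k+1≡ : k + suc k ≡ 2 * suc k ∸ 1
  2k+1≡ = cong (λ t → k + suc t) (sym (+-identityʳ k))
  2k+2≡ : k + suc k + 1 ≡ 2 * suc k
  2k+2≡ = identity k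
    where
    identity : ∀ k → k + suc k + 1 ≡ 2 * suc k
    identity = solve-∀

mainTheorem6 :
    (∀ (a b n : ℕ) (G : Graph n) → a < b → MinDegreeAtLeast G (a + b) →
       GammaBound a b G (2 * b) (2 * b + 1))
    × (∀ (a b n : ℕ) (G : Graph n) → a < b → MinDegreeAtLeast G (a + b) →
       HasSpanningRegular G (b ∸ a) →
       GammaBound a b G (a + b) (a + b + 1))
    × (∀ (k n : ℕ) (G : Graph n) → 1 ≤ k → MinDegreeAtLeast G (2 * k ∸ 1) →
       HasPerfectMatching G →
       GammaBound (k ∸ 1) k G (2 * k ∸ 1) (2 * k))
mainTheorem6 = general-bound , regular-bound , matching-bound
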